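{- Let $V = \{(L,W) \in \mathbb{Q}^2 : L^2 - L + 1 = W^2\}$. The map $\varphi: \mathbb{Q} \setminus \{1/2\} \to V$ given by \[\varphi(s) = \left(\frac{s^2-1}{2s-1}, \frac{s^2-s+1}{2s-1}\right)\] is a bijection. -}

module Defs where

open import Data.Rational using (ℚ; 0ℚ; 1ℚ; _+_; _-_; _*_; _÷_; ≢-nonZero; _≟_)
open import Data.Product using (_×_; _,_)
open import Relation.Nullary using (yes; no)
open import Relation.Binary.PropositionalEquality using (_≡_)

InV : ℚ × ℚ → Set
InV (L , W) = L * L - L + 1ℚ ≡ W * W

-- Safe division: p ÷ q when q ≠ 0 (junk value 0 when q = 0; never used
-- in the statement since 2s-1 ≠ 0 for s ≠ 1/2).
_÷'_ : ℚ → ℚ → ℚ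
p ÷' q with q ≟ 0ℚ
... | yes _ = 0ℚ
... | no q≢0 = _÷_ p q {{≢-nonZero q≢0}}

2ℚ : ℚ
2ℚ = 1ℚ + 1ℚ

φ : ℚ → ℚ × ℚ
φ s = ((s * s - 1ℚ) ÷' (2ℚ * s - 1ℚ)) , ((s * s - s + 1ℚ) ÷' (2ℚ * s - 1ℚ))

-- V is a conic through the point at infinity in the direction (1 , -1):
-- substituting W = s - L into its equation leaves the linear equation
-- (2s - 1) L = s² - 1.  So for s ≠ ½ the line L + W = s meets V in exactly
-- one point, namely φ(s), while s = ½ is an asymptote missing V.  Hence
-- (L , W) ↦ L + W is the inverse of φ.
module Submission where

open import Defs
open import Data.Rational using (ℚ; ½; 0ℚ; 1ℚ; _+_; _-_; _*_; 1/_; ≢-nonZero; _≟_)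
open import Data.Rational.Properties
  using (+-*-commutativeRing; *-assoc; *-distribʳ-+; *-identityʳ; *-inverseˡ; *-inverseʳ; *-zeroʳ)
open import Data.Product using (_×_; _,_; ∃-syntax; proj₁; proj₂)
open import Data.List.Base using (_∷_; [])
open import Level using (0ℓ)
open import Relation.Nullary using (yes; no; contradiction)
open import Relation.Nullary.Decidable using (dec⇒maybe)
open import Relation.Binary.PropositionalEquality
  using (_≡_; _≢_; refl; sym; trans; cong; cong₂; module ≡-Reasoning)
open import Tactic.RingSolver using (solve)
import Tactic.RingSolver.Core.AlmostCommutativeRing as ACR

open ≡-Reasoning

ℚ-ring : ACR.AlmostCommutativeRing 0ℓ 0ℓ
ℚ-ring = ACR.fromCommutativeRing +-*-commutativeRing (λ x → dec⇒maybe (0ℚ ≟ x))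

÷'-≢0 : ∀ p {q} (q≢0 : q ≢ 0ℚ) → p ÷' q ≡ p * (1/ q) {{≢-nonZero q≢0}}
÷'-≢0 p {q} q≢0 with q ≟ 0ℚ
... | yes q≡0 = contradiction q≡0 q≢0
... | no _    = refl

*-÷'-cancelʳ : ∀ p {q} → q ≢ 0ℚ → (p * q) ÷' q ≡ p
*-÷'-cancelʳ p {q} q≢0 = begin
  (p * q) ÷' q        ≡⟨ ÷'-≢0 (p * q) q≢0 ⟩
  p * q * (1/ q)      ≡⟨ *-assoc p q _ ⟩
  p * (q * (1/ q))    ≡⟨ cong (p *_) (*-inverseʳ q) ⟩
  p * 1ℚ              ≡⟨ *-identityʳ p ⟩
  p                   ∎
  where instance _ = ≢-nonZero q≢0

÷'-*-cancelʳ : ∀ p {q} → q ≢ 0ℚ → (p ÷' q) * q ≡ p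
÷'-*-cancelʳ p {q} q≢0 = begin
  (p ÷' q) * q        ≡⟨ cong (_* q) (÷'-≢0 p q≢0) ⟩
  p * (1/ q) * q      ≡⟨ *-assoc p _ q ⟩
  p * ((1/ q) * q)    ≡⟨ cong (p *_) (*-inverseˡ q) ⟩
  p * 1ℚ              ≡⟨ *-identityʳ p ⟩
  p                   ∎
  where instance _ = ≢-nonZero q≢0

÷'-unique : ∀ {p q r} → q ≢ 0ℚ → p ≡ r * q → p ÷' q ≡ r
÷'-unique {q = q} {r} q≢0 p≡rq = trans (cong (_÷' q) p≡rq) (*-÷'-cancelʳ r q≢0)

*-cancelʳ-≢0 : ∀ {p q r} → r ≢ 0ℚ → p * r ≡ q * r → p ≡ q
*-cancelʳ-≢0 {p} {q} {r} r≢0 pr≡qr =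
  trans (sym (*-÷'-cancelʳ p r≢0)) (÷'-unique r≢0 pr≡qr)

÷'-+ : ∀ p q {r} → r ≢ 0ℚ → p ÷' r + q ÷' r ≡ (p + q) ÷' r
÷'-+ p q {r} r≢0 = sym (÷'-unique r≢0 (begin
  p + q                           ≡⟨ sym (cong₂ _+_ (÷'-*-cancelʳ p r≢0) (÷'-*-cancelʳ q r≢0)) ⟩
  (p ÷' r) * r + (q ÷' r) * r     ≡⟨ sym (*-distribʳ-+ r (p ÷' r) (q ÷' r)) ⟩
  (p ÷' r + q ÷' r) * r           ∎))

-- Dehomogenisation: a rational point [A : B : d] of the projective closure
-- of V with d ≠ 0 gives the point (A/d , B/d) of V.
InV-÷' : ∀ {A B d} → d ≢ 0ℚ → A * A - A * d + d * d ≡ B * B → InV (A ÷' d , B ÷' d)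
InV-÷' {A} {B} {d} d≢0 cone = InV-scaled (A ÷' d) (B ÷' d) (begin
  (A ÷' d * d) * (A ÷' d * d) - (A ÷' d * d) * d + d * d
    ≡⟨ cong (λ x → x * x - x * d + d * d) (÷'-*-cancelʳ A d≢0) ⟩
  A * A - A * d + d * d
    ≡⟨ cone ⟩
  B * B
    ≡⟨ cong (λ y → y * y) (sym (÷'-*-cancelʳ B d≢0)) ⟩
  (B ÷' d * d) * (B ÷' d * d)
    ∎)
  where
  InV-scaled : ∀ L W → (L * d) * (L * d) - (L * d) * d + d * d ≡ (W * d) * (W * d) → InV (L , W)
  InV-scaled L W scaled = *-cancelʳ-≢0 d≢0 (*-cancelʳ-≢0 d≢0 (begin
    (L * L - L + 1ℚ) * d * d                  ≡⟨ solve (L ∷ d ∷ []) ℚ-ring ⟩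
    (L * d) * (L * d) - (L * d) * d + d * d   ≡⟨ scaled ⟩
    (W * d) * (W * d)                         ≡⟨ solve (W ∷ d ∷ []) ℚ-ring ⟩
    W * W * d * d                             ∎))

2s-1≢0 : ∀ {s} → s ≢ ½ → 2ℚ * s - 1ℚ ≢ 0ℚ
2s-1≢0 {s} s≢½ 2s-1≡0 = s≢½ (begin
  s                          ≡⟨ solve (s ∷ []) ℚ-ring ⟩
  (2ℚ * s - 1ℚ + 1ℚ) * ½     ≡⟨ cong (λ x → (x + 1ℚ) * ½) 2s-1≡0 ⟩
  ½                          ∎)

φ-InV : ∀ s → s ≢ ½ → InV (φ s)
φ-InV s s≢½ = InV-÷' (2s-1≢0 s≢½) cone
  where
  cone : (s * s - 1ℚ) * (s * s - 1ℚ) - (s * s - 1ℚ) * (2ℚ * s - 1ℚ) + (2ℚ * s - 1ℚ) * (2ℚ * s - 1ℚ)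
         ≡ (s * s - s + 1ℚ) * (s * s - s + 1ℚ)
  cone = solve (s ∷ []) ℚ-ring

φ-sum : ∀ s → s ≢ ½ → proj₁ (φ s) + proj₂ (φ s) ≡ s
φ-sum s s≢½ = trans (÷'-+ (s * s - 1ℚ) (s * s - s + 1ℚ) d≢0) (÷'-unique d≢0 (solve (s ∷ []) ℚ-ring))
  where d≢0 = 2s-1≢0 s≢½

φ-injective : ∀ s t → s ≢ ½ → t ≢ ½ → φ s ≡ φ t → s ≡ t
φ-injective s t s≢½ t≢½ φs≡φt = begin
  s                           ≡⟨ sym (φ-sum s s≢½) ⟩
  proj₁ (φ s) + proj₂ (φ s)   ≡⟨ cong (λ p → proj₁ p + proj₂ p) φs≡φt ⟩
  proj₁ (φ t) + proj₂ (φ t)   ≡⟨ φ-sum t t≢½ ⟩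
  t                           ∎

φ-surjective : ∀ L W → InV (L , W) → ∃[ s ] (s ≢ ½ × φ s ≡ (L , W))
φ-surjective L W onV = L + W , s≢½ , cong₂ _,_ (÷'-unique d≢0 numerator₁) (÷'-unique d≢0 numerator₂)
  where
  numerator₁ : (L + W) * (L + W) - 1ℚ ≡ L * (2ℚ * (L + W) - 1ℚ)
  numerator₁ = begin
    (L + W) * (L + W) - 1ℚ
      ≡⟨ solve (L ∷ W ∷ []) ℚ-ring ⟩
    L * (2ℚ * (L + W) - 1ℚ) + (W * W - (L * L - L + 1ℚ))
      ≡⟨ cong (λ x → L * (2ℚ * (L + W) - 1ℚ) + (W * W - x)) onV ⟩
    L * (2ℚ * (L + W) - 1ℚ) + (W * W - W * W)
      ≡⟨ solve (L ∷ W ∷ []) ℚ-ring ⟩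
    L * (2ℚ * (L + W) - 1ℚ)
      ∎

  numerator₂ : (L + W) * (L + W) - (L + W) + 1ℚ ≡ W * (2ℚ * (L + W) - 1ℚ)
  numerator₂ = begin
    (L + W) * (L + W) - (L + W) + 1ℚ
      ≡⟨ solve (L ∷ W ∷ []) ℚ-ring ⟩
    W * (2ℚ * (L + W) - 1ℚ) + ((L * L - L + 1ℚ) - W * W)
      ≡⟨ cong (λ x → W * (2ℚ * (L + W) - 1ℚ) + (x - W * W)) onV ⟩
    W * (2ℚ * (L + W) - 1ℚ) + (W * W - W * W)
      ≡⟨ solve (L ∷ W ∷ []) ℚ-ring ⟩
    W * (2ℚ * (L + W) - 1ℚ)
      ∎

  s≢½ : L + W ≢ ½
  s≢½ s≡½ = ¼-1≢0 (begin
    ½ * ½ - 1ℚ                 ≡⟨ cong (λ s → s * s - 1ℚ) (sym s≡½) ⟩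
    (L + W) * (L + W) - 1ℚ     ≡⟨ numerator₁ ⟩
    L * (2ℚ * (L + W) - 1ℚ)    ≡⟨ cong (λ s → L * (2ℚ * s - 1ℚ)) s≡½ ⟩
    L * 0ℚ                     ≡⟨ *-zeroʳ L ⟩
    0ℚ                         ∎)
    where
    ¼-1≢0 : ½ * ½ - 1ℚ ≢ 0ℚ
    ¼-1≢0 ()

  d≢0 : 2ℚ * (L + W) - 1ℚ ≢ 0ℚ
  d≢0 = 2s-1≢0 s≢½

proposition3p1 : ((s : ℚ) → s ≢ ½ → InV (φ s))
                 × ((s t : ℚ) → s ≢ ½ → t ≢ ½ → φ s ≡ φ t → s ≡ t)
                 × ((L W : ℚ) → InV (L , W) → ∃[ s ] (s ≢ ½ × φ s ≡ (L , W)))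
proposition3p1 = φ-InV , φ-injective , φ-surjective
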